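{- Let $D\in\mathbb{Z}_{\le0}$ and let $d\ge1$ be an integer coprime to $D$. Then for every $s\in\mathbb{Z}^n$ with $D\equiv\frac12qS^{ -1}[s]\pmod{qd}$, the vector $$\xi=\left(\tfrac{\frac12qS^{ -1}[s]-D}{qd},\,S^{ -1}s,\,d\right)^t$$ belongs to $L_0\!\left[-\tfrac Dq,\tfrac12\mathbb{Z}\right]$.
   Context: **Matrix and level.** - $S$ is an even positive definite symmetric integral $n\times n$ matrix ($n\ge1$), with $S^{ -1}[s]=s^tS^{ -1}s$. - The level $q$ is the least positive integer with $\frac12qS^{ -1}[x]\in\mathbb{Z}$ for all $x\in\mathbb{Z}^n$. **Quadratic space.** - $S_0=\begin{pmatrix}0&0&1\\0&-S&0\\1&0&0\end{pmatrix}$, $V_0=\mathbb{Q}^{n+2}$ and $\phi_0(x,y)=\frac12x^tS_0y$, with $\phi_0[x]=\phi_0(x,x)$. - $L_0=\mathbb{Z}^{n+2}$. - For a lattice $\Lambda\subset V_0$, $c\in\mathbb{Q}^\times$ and a fractional ideal $\mathfrak b$ of $\mathbb{Q}$, let $\Lambda[c,\mathfrak b]=\{x\in V_0:\phi_0[x]=c\text{ and }\{\phi_0(x,y):y\in\Lambda\}=\mathfrak b\}$. -}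

module Defs where

open import Data.Nat as ℕ using (ℕ; zero; suc)
open import Data.Integer as ℤ using (ℤ; +_)
open import Data.Rational as ℚ using (ℚ; _/_; ½)
open import Data.Fin using (Fin; zero; suc; splitAt)
open import Data.Sum using (inj₁; inj₂)
open import Data.Product using (Σ; ∃; _×_; _,_)
open import Relation.Binary.PropositionalEquality using (_≡_)
open import Relation.Nullary using (¬_)

toℚ : ℤ → ℚ
toℚ z = z / 1

Vec : Set → ℕ → Set
Vec A n = Fin n → A

Mat : Set → ℕ → Set
Mat A n = Fin n → Fin n → A

Σᶠ : (n : ℕ) → (Fin n → ℚ) → ℚ
Σᶠ zero    f = ℚ.0ℚ
Σᶠ (suc n) f = f zero ℚ.+ Σᶠ n (λ i → f (suc i))

vecℚ : ∀ {n} → Vec ℤ n → Vec ℚ n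
vecℚ v i = toℚ (v i)

matℚ : ∀ {n} → Mat ℤ n → Mat ℚ n
matℚ M i j = toℚ (M i j)

_·ᵥ_ : ∀ {n} → Mat ℚ n → Vec ℚ n → Vec ℚ n
_·ᵥ_ {n} M x i = Σᶠ n (λ j → M i j ℚ.* x j)

bil : ∀ {n} → Mat ℚ n → Vec ℚ n → Vec ℚ n → ℚ
bil {n} M x y = Σᶠ n (λ i → x i ℚ.* (M ·ᵥ y) i)

_[_] : ∀ {n} → Mat ℚ n → Vec ℚ n → ℚ
M [ x ] = bil M x x

idMat : ∀ {n} → Mat ℚ n
idMat zero    zero    = ℚ.1ℚ
idMat zero    (suc j) = ℚ.0ℚ
idMat (suc i) zero    = ℚ.0ℚ
idMat (suc i) (suc j) = idMat i j

_·ₘ_ : ∀ {n} → Mat ℚ n → Mat ℚ n → Mat ℚ n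
_·ₘ_ {n} A B i k = Σᶠ n (λ j → A i j ℚ.* B j k)

IsInverse : ∀ {n} → Mat ℤ n → Mat ℚ n → Set
IsInverse S T = (matℚ S ·ₘ T) ≡ idMat × (T ·ₘ matℚ S) ≡ idMat

Symmetric : ∀ {n} → Mat ℤ n → Set
Symmetric S = ∀ i j → S i j ≡ S j i

Even : ∀ {n} → Mat ℤ n → Set
Even S = ∀ i → ∃ λ k → S i i ≡ (+ 2) ℤ.* k

PosDef : ∀ {n} → Mat ℤ n → Set
PosDef {n} S = ∀ (x : Vec ℚ n) → ¬ (∀ i → x i ≡ ℚ.0ℚ) → ℚ.0ℚ ℚ.< matℚ S [ x ]

IsIntegerℚ : ℚ → Set
IsIntegerℚ r = ∃ λ (k : ℤ) → r ≡ toℚ k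

LevelProp : ∀ {n} → Mat ℚ n → ℕ → Set
LevelProp Sinv q = ∀ x → IsIntegerℚ (½ ℚ.* toℚ (+ q) ℚ.* (Sinv [ vecℚ x ]))

IsLevel : ∀ {n} → Mat ℚ n → ℕ → Set
IsLevel Sinv q = 0 ℕ.< q × LevelProp Sinv q
               × (∀ q′ → 0 ℕ.< q′ → LevelProp Sinv q′ → q ℕ.≤ q′)

-- the quadratic space V₀ = ℚ^{n+2}; coordinates ordered as 1 + (n + 1)
dim₀ : ℕ → ℕ
dim₀ n = 1 ℕ.+ (n ℕ.+ 1)

-- S₀ = [[0,0,1],[0,-S,0],[1,0,0]] in block form
S₀ : ∀ {n} → Mat ℤ n → Mat ℤ (dim₀ n)
S₀ {n} S i j with splitAt 1 i | splitAt 1 j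
... | inj₁ _ | inj₁ _ = + 0
... | inj₁ _ | inj₂ j′ with splitAt n j′
...   | inj₁ _ = + 0
...   | inj₂ _ = + 1
S₀ {n} S i j | inj₂ i′ | inj₁ _ with splitAt n i′
...   | inj₁ _ = + 0
...   | inj₂ _ = + 1
S₀ {n} S i j | inj₂ i′ | inj₂ j′ with splitAt n i′ | splitAt n j′
...   | inj₁ a | inj₁ b = ℤ.- S a b
...   | _      | _      = + 0

φ₀ : ∀ {n} → Mat ℤ n → Vec ℚ (dim₀ n) → Vec ℚ (dim₀ n) → ℚ
φ₀ S x y = ½ ℚ.* bil (matℚ (S₀ S)) x y

In½ℤ : ℚ → Set
In½ℤ r = ∃ λ (k : ℤ) → r ≡ k / 2

-- L₀ = ℤ^{n+2} ; Λ[c, 𝔟] for Λ = L₀ and 𝔟 = ½ℤ :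
-- φ₀[x] = c and {φ₀(x,y) : y ∈ L₀} = ½ℤ
InL₀½ℤ : ∀ {n} → ℚ → Mat ℤ n → Vec ℚ (dim₀ n) → Set
InL₀½ℤ c S x =
  φ₀ S x x ≡ c
  × (∀ (y : Vec ℤ (dim₀ _)) → In½ℤ (φ₀ S x (vecℚ y)))
  × (∀ r → In½ℤ r → ∃ λ (y : Vec ℤ (dim₀ _)) → φ₀ S x (vecℚ y) ≡ r)

triple : ∀ {n} → ℚ → Vec ℚ n → ℚ → Vec ℚ (dim₀ n)
triple {n} a v b i with splitAt 1 i
... | inj₁ _ = a
... | inj₂ i′ with splitAt n i′
...   | inj₁ k = v k
...   | inj₂ _ = b

-- r / m for a positive natural m (value at m = 0 is a dummy, never used)
divℚ : ℚ → ℕ → ℚ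
divℚ r zero    = ℚ.0ℚ
divℚ r (suc m) = r ℚ.* ((+ 1) / suc m)

{-# OPTIONS --safe #-}

-- Write y ∈ V₀ as (y₀, y′, y₁).  The first entry of ξ is the integer k of the hypothesis, and
-- v = S⁻¹s satisfies vᵗ S w = sᵗ w, so φ₀(ξ, y) = ½ (k y₁ + d y₀ − sᵗ y′) for every y.  Taking
-- y = ξ gives φ₀[ξ] = kd − ½ S⁻¹[s] = −D/q, and for y ∈ L₀ the value lies in ½ℤ.  Every element
-- of ½ℤ is attained because 1 is an integral combination of d, s₁, …, sₙ: a common divisor g of
-- these divides ½ q S⁻¹[s] (which lies in g²ℤ by the definition of the level) and kqd, hence
-- D = ½ q S⁻¹[s] − kqd, and D is coprime to d.

module Submission where

open import Defs
open import Data.Nat as ℕ using (ℕ; zero; suc; NonZero)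
import Data.Nat.Properties as ℕP
open import Data.Nat.Coprimality using (Coprime)
open import Data.Nat.GCD using (module Bézout; module GCD)
open import Data.Integer as ℤ using (ℤ; +_)
import Data.Integer.Properties as ℤP
import Data.Integer.GCD as ℤGCD
open import Data.Integer.Divisibility.Signed
  using (_∣_; divides; ∣ᵤ⇒∣; ∣⇒∣ᵤ; ∣-refl; ∣-trans; m∣∣m∣; ∣m∣n⇒∣m-n; ∣m⇒∣m*n; ∣n⇒∣m*n)
import Data.Integer.Solver as ℤ-Solver
open import Data.Rational as ℚ using (ℚ; _+_; _*_; -_; _-_; 0ℚ; 1ℚ; ½; _/_; toℚᵘ; ↥_)
import Data.Rational.Properties as ℚP
import Data.Rational.Solver as ℚ-Solver
open import Data.Rational.Unnormalised as ℚᵘ using (mkℚᵘ; *≡*)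
import Data.Rational.Unnormalised.Properties as ℚᵘP
open import Data.Fin using (Fin; zero; suc; splitAt; _↑ˡ_; _↑ʳ_)
open import Data.Fin.Properties using (splitAt-↑ˡ; splitAt-↑ʳ)
open import Data.Vec.Functional using (_∷_)
open import Data.Sum using (inj₁; inj₂)
open import Data.Product using (∃; ∃-syntax; _×_; _,_; proj₁; proj₂)
open import Function using (_∘_)
open import Relation.Binary.PropositionalEquality hiding ([_])
open import Algebra.Bundles using (Ring)
import Algebra.Properties.Semiring.Sum as SemiringSum

module ΣQ = SemiringSum (Ring.semiring ℚP.+-*-ring)
module ΣZ = SemiringSum ℤP.+-*-semiring

toℚᵘ-/ : ∀ z m → toℚᵘ (z / suc m) ℚᵘ.≃ mkℚᵘ z m
toℚᵘ-/ z m = ℚP.toℚᵘ-fromℚᵘ (mkℚᵘ z m)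

toℚ-+ : ∀ a b → toℚ (a ℤ.+ b) ≡ toℚ a + toℚ b
toℚ-+ a b = ℚP.toℚᵘ-injective (begin
  toℚᵘ (toℚ (a ℤ.+ b))            ≈⟨ toℚᵘ-/ (a ℤ.+ b) 0 ⟩
  mkℚᵘ (a ℤ.+ b) 0                ≈⟨ *≡* (solve 2 (λ a b → (a :+ b) :* con (+ 1) := (a :* con (+ 1) :+ b :* con (+ 1)) :* con (+ 1)) refl a b) ⟩
  mkℚᵘ a 0 ℚᵘ.+ mkℚᵘ b 0          ≈⟨ ℚᵘP.+-cong (toℚᵘ-/ a 0) (toℚᵘ-/ b 0) ⟨
  toℚᵘ (toℚ a) ℚᵘ.+ toℚᵘ (toℚ b)  ≈⟨ ℚP.toℚᵘ-homo-+ (toℚ a) (toℚ b) ⟨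
  toℚᵘ (toℚ a + toℚ b)            ∎)
  where
  open ℚᵘP.≃-Reasoning
  open ℤ-Solver.+-*-Solver

toℚ-* : ∀ a b → toℚ (a ℤ.* b) ≡ toℚ a * toℚ b
toℚ-* a b = ℚP.toℚᵘ-injective (begin
  toℚᵘ (toℚ (a ℤ.* b))            ≈⟨ toℚᵘ-/ (a ℤ.* b) 0 ⟩
  mkℚᵘ a 0 ℚᵘ.* mkℚᵘ b 0          ≈⟨ ℚᵘP.*-cong (toℚᵘ-/ a 0) (toℚᵘ-/ b 0) ⟨
  toℚᵘ (toℚ a) ℚᵘ.* toℚᵘ (toℚ b)  ≈⟨ ℚP.toℚᵘ-homo-* (toℚ a) (toℚ b) ⟨
  toℚᵘ (toℚ a * toℚ b)            ∎)
  where
  open ℚᵘP.≃-Reasoning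

toℚ-neg : ∀ a → toℚ (ℤ.- a) ≡ - toℚ a
toℚ-neg a = ℚP.toℚᵘ-injective (begin
  toℚᵘ (toℚ (ℤ.- a))    ≈⟨ toℚᵘ-/ (ℤ.- a) 0 ⟩
  ℚᵘ.- mkℚᵘ a 0         ≈⟨ ℚᵘP.-‿cong (toℚᵘ-/ a 0) ⟨
  ℚᵘ.- toℚᵘ (toℚ a)     ≈⟨ ℚP.toℚᵘ-homo‿- (toℚ a) ⟨
  toℚᵘ (- toℚ a)        ∎)
  where
  open ℚᵘP.≃-Reasoning

toℚ-- : ∀ a b → toℚ (a ℤ.- b) ≡ toℚ a - toℚ b
toℚ-- a b = trans (toℚ-+ a (ℤ.- b)) (cong (λ x → toℚ a + x) (toℚ-neg b))

↥-toℚ : ∀ z → ↥ toℚ z ≡ z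
↥-toℚ z = begin
  ↥ toℚ z                          ≡⟨ ℤP.*-identityʳ _ ⟨
  ↥ toℚ z ℤ.* + 1                  ≡⟨ cong (↥ toℚ z ℤ.*_) (ℤGCD.gcd-zeroʳ z) ⟨
  ↥ toℚ z ℤ.* ℤGCD.gcd z (+ 1)     ≡⟨ ℚP.↥-/ z 1 ⟩
  z                                ∎
  where
  open ≡-Reasoning

toℚ-injective : ∀ {a b} → toℚ a ≡ toℚ b → a ≡ b
toℚ-injective {a} {b} eq = trans (sym (↥-toℚ a)) (trans (cong ↥_ eq) (↥-toℚ b))

z/n≡z*1/n : ∀ z m → z / suc m ≡ toℚ z * (+ 1 / suc m)
z/n≡z*1/n z m = ℚP.toℚᵘ-injective (begin
  toℚᵘ (z / suc m)                           ≈⟨ toℚᵘ-/ z m ⟩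
  mkℚᵘ z m                                   ≈⟨ *≡* eq ⟩
  mkℚᵘ z 0 ℚᵘ.* mkℚᵘ (+ 1) m                 ≈⟨ ℚᵘP.*-cong (toℚᵘ-/ z 0) (toℚᵘ-/ (+ 1) m) ⟨
  toℚᵘ (toℚ z) ℚᵘ.* toℚᵘ (+ 1 / suc m)       ≈⟨ ℚP.toℚᵘ-homo-* (toℚ z) (+ 1 / suc m) ⟨
  toℚᵘ (toℚ z * (+ 1 / suc m))               ∎)
  where
  open ℚᵘP.≃-Reasoning
  eq : z ℤ.* + (1 ℕ.* suc m) ≡ (z ℤ.* + 1) ℤ.* + suc m
  eq = trans (cong (λ t → z ℤ.* + t) (ℕP.*-identityˡ (suc m))) (cong (ℤ._* + suc m) (sym (ℤP.*-identityʳ z)))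

n/n≡1 : ∀ m → + suc m / suc m ≡ 1ℚ
n/n≡1 m = ℚP.toℚᵘ-injective (ℚᵘP.≃-trans (toℚᵘ-/ (+ suc m) m) (*≡* (ℤP.*-comm (+ suc m) (+ 1))))

½*z≡z/2 : ∀ z → ½ * toℚ z ≡ z / 2
½*z≡z/2 z = trans (ℚP.*-comm ½ (toℚ z)) (sym (z/n≡z*1/n z 1))

½*[p+p]≡p : ∀ p → ½ * (p + p) ≡ p
½*[p+p]≡p p = trans (solve 2 (λ h p → h :* (p :+ p) := (h :+ h) :* p) refl ½ p) (ℚP.*-identityˡ p)
  where
  open ℚ-Solver.+-*-Solver

divℚ[m*r,m]≡r : ∀ m .{{_ : NonZero m}} r → divℚ (toℚ (+ m) * r) m ≡ r
divℚ[m*r,m]≡r (suc m) r = begin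
  toℚ (+ suc m) * r * (+ 1 / suc m)      ≡⟨ solve 3 (λ M r i → M :* r :* i := r :* (M :* i)) refl (toℚ (+ suc m)) r (+ 1 / suc m) ⟩
  r * (toℚ (+ suc m) * (+ 1 / suc m))    ≡⟨ cong (r *_) (z/n≡z*1/n (+ suc m) m) ⟨
  r * (+ suc m / suc m)                  ≡⟨ cong (r *_) (n/n≡1 m) ⟩
  r * 1ℚ                                 ≡⟨ ℚP.*-identityʳ r ⟩
  r                                      ∎
  where
  open ≡-Reasoning
  open ℚ-Solver.+-*-Solver

Σᶠ≡sum : ∀ n f → Σᶠ n f ≡ ΣQ.sum f
Σᶠ≡sum zero    f = refl
Σᶠ≡sum (suc n) f = cong (λ x → f zero + x) (Σᶠ≡sum n (f ∘ suc))

Σᶠ-cong : ∀ n {f g : Fin n → ℚ} → (∀ i → f i ≡ g i) → Σᶠ n f ≡ Σᶠ n g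
Σᶠ-cong n {f} {g} f≗g = trans (Σᶠ≡sum n f) (trans (ΣQ.sum-cong-≗ f≗g) (sym (Σᶠ≡sum n g)))

Σᶠ-*ˡ : ∀ n c (f : Fin n → ℚ) → c * Σᶠ n f ≡ Σᶠ n (λ i → c * f i)
Σᶠ-*ˡ n c f = trans (cong (c *_) (Σᶠ≡sum n f)) (trans (ΣQ.*-distribˡ-sum c f) (sym (Σᶠ≡sum n _)))

Σᶠ-*ʳ : ∀ n c (f : Fin n → ℚ) → Σᶠ n f * c ≡ Σᶠ n (λ i → f i * c)
Σᶠ-*ʳ n c f = trans (cong (_* c) (Σᶠ≡sum n f)) (trans (ΣQ.*-distribʳ-sum c f) (sym (Σᶠ≡sum n _)))

Σᶠ-comm : ∀ m n (f : Fin m → Fin n → ℚ) →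
          Σᶠ m (λ i → Σᶠ n (f i)) ≡ Σᶠ n (λ j → Σᶠ m (λ i → f i j))
Σᶠ-comm m n f = begin
  Σᶠ m (λ i → Σᶠ n (f i))                    ≡⟨ Σᶠ-cong m (λ i → Σᶠ≡sum n (f i)) ⟩
  Σᶠ m (λ i → ΣQ.sum (f i))                  ≡⟨ Σᶠ≡sum m _ ⟩
  ΣQ.sum (λ i → ΣQ.sum (f i))                ≡⟨ ΣQ.∑-comm f ⟩
  ΣQ.sum (λ j → ΣQ.sum (λ i → f i j))        ≡⟨ Σᶠ≡sum n _ ⟨
  Σᶠ n (λ j → ΣQ.sum (λ i → f i j))          ≡⟨ Σᶠ-cong n (λ j → Σᶠ≡sum m _) ⟨
  Σᶠ n (λ j → Σᶠ m (λ i → f i j))            ∎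
  where
  open ≡-Reasoning

Σᶠ-neg : ∀ n (f : Fin n → ℚ) → - Σᶠ n f ≡ Σᶠ n (λ i → - f i)
Σᶠ-neg zero    f = refl
Σᶠ-neg (suc n) f = trans (ℚP.neg-distrib-+ (f zero) _) (cong (λ x → - f zero + x) (Σᶠ-neg n (f ∘ suc)))

Σᶠ-zeroˡ : ∀ n (f : Fin n → ℚ) → Σᶠ n (λ i → 0ℚ * f i) ≡ 0ℚ
Σᶠ-zeroˡ n f = trans (sym (Σᶠ-*ˡ n 0ℚ f)) (ℚP.*-zeroˡ (Σᶠ n f))

Σᶠ-↑ : ∀ m n (f : Fin (m ℕ.+ n) → ℚ) →
       Σᶠ (m ℕ.+ n) f ≡ Σᶠ m (λ i → f (i ↑ˡ n)) + Σᶠ n (λ j → f (m ↑ʳ j))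
Σᶠ-↑ zero    n f = sym (ℚP.+-identityˡ _)
Σᶠ-↑ (suc m) n f = trans (cong (λ x → f zero + x) (Σᶠ-↑ m n (f ∘ suc))) (sym (ℚP.+-assoc (f zero) _ _))

toℚ-sum : ∀ n (f : Fin n → ℤ) → toℚ (ΣZ.sum f) ≡ Σᶠ n (λ i → toℚ (f i))
toℚ-sum zero    f = refl
toℚ-sum (suc n) f = trans (toℚ-+ (f zero) (ΣZ.sum (f ∘ suc))) (cong (λ x → toℚ (f zero) + x) (toℚ-sum n (f ∘ suc)))

bil-transpose : ∀ {n} (M : Mat ℚ n) x y → bil M x y ≡ Σᶠ n (λ j → Σᶠ n (λ i → x i * M i j) * y j)
bil-transpose {n} M x y = begin
  Σᶠ n (λ i → x i * Σᶠ n (λ j → M i j * y j))      ≡⟨ Σᶠ-cong n (λ i → Σᶠ-*ˡ n (x i) _) ⟩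
  Σᶠ n (λ i → Σᶠ n (λ j → x i * (M i j * y j)))    ≡⟨ Σᶠ-comm n n _ ⟩
  Σᶠ n (λ j → Σᶠ n (λ i → x i * (M i j * y j)))    ≡⟨ Σᶠ-cong n (λ j → Σᶠ-cong n (λ i → ℚP.*-assoc (x i) (M i j) (y j))) ⟨
  Σᶠ n (λ j → Σᶠ n (λ i → x i * M i j * y j))      ≡⟨ Σᶠ-cong n (λ j → Σᶠ-*ʳ n (y j) _) ⟨
  Σᶠ n (λ j → Σᶠ n (λ i → x i * M i j) * y j)      ∎
  where
  open ≡-Reasoning

·ᵥ-·ₘ : ∀ {n} (A B : Mat ℚ n) x i → (A ·ᵥ (B ·ᵥ x)) i ≡ ((A ·ₘ B) ·ᵥ x) i
·ᵥ-·ₘ A B x i = bil-transpose B (A i) x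

idMat-·ᵥ : ∀ {n} (x : Vec ℚ n) i → (idMat ·ᵥ x) i ≡ x i
idMat-·ᵥ {suc n} x zero    = trans (cong₂ _+_ (ℚP.*-identityˡ (x zero)) (Σᶠ-zeroˡ n (x ∘ suc))) (ℚP.+-identityʳ (x zero))
idMat-·ᵥ {suc n} x (suc i) = trans (cong₂ _+_ (ℚP.*-zeroˡ (x zero)) (idMat-·ᵥ (x ∘ suc) i)) (ℚP.+-identityˡ (x (suc i)))

·ᵥ-inverse : ∀ {n} {M T : Mat ℚ n} → M ·ₘ T ≡ idMat → ∀ x i → (M ·ᵥ (T ·ᵥ x)) i ≡ x i
·ᵥ-inverse {M = M} {T} M·T≡I x i =
  trans (·ᵥ-·ₘ M T x i) (trans (cong (λ P → (P ·ᵥ x) i) M·T≡I) (idMat-·ᵥ x i))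

bil-comm : ∀ {n} {M : Mat ℚ n} → (∀ i j → M i j ≡ M j i) → ∀ x y → bil M x y ≡ bil M y x
bil-comm {n} {M} M-sym x y = trans (bil-transpose M x y) (Σᶠ-cong n λ j →
  trans (ℚP.*-comm _ (y j)) (cong (y j *_) (Σᶠ-cong n λ i →
    trans (ℚP.*-comm (x i) (M i j)) (cong (_* x i) (M-sym i j)))))

bil-inverse : ∀ {n} {M T : Mat ℚ n} → (∀ i j → M i j ≡ M j i) → M ·ₘ T ≡ idMat →
              ∀ x y → bil M (T ·ᵥ x) y ≡ Σᶠ n (λ i → x i * y i)
bil-inverse {n} {M} {T} M-sym M·T≡I x y = begin
  bil M (T ·ᵥ x) y                   ≡⟨ bil-comm M-sym (T ·ᵥ x) y ⟩
  Σᶠ n (λ i → y i * (M ·ᵥ (T ·ᵥ x)) i) ≡⟨ Σᶠ-cong n (λ i → cong (y i *_) (·ᵥ-inverse {M = M} {T} M·T≡I x i)) ⟩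
  Σᶠ n (λ i → y i * x i)               ≡⟨ Σᶠ-cong n (λ i → ℚP.*-comm (y i) (x i)) ⟩
  Σᶠ n (λ i → x i * y i)               ∎
  where
  open ≡-Reasoning

bil-congˡ : ∀ {n} (M : Mat ℚ n) {x x′} → (∀ i → x i ≡ x′ i) → ∀ y → bil M x y ≡ bil M x′ y
bil-congˡ {n} M x≗x′ y = Σᶠ-cong n (λ i → cong (_* (M ·ᵥ y) i) (x≗x′ i))

[]-scale : ∀ {n} (M : Mat ℚ n) c {x y} → (∀ i → x i ≡ c * y i) → M [ x ] ≡ c * c * M [ y ]
[]-scale {n} M c {x} {y} x≗cy = begin
  Σᶠ n (λ i → x i * Σᶠ n (λ j → M i j * x j))
    ≡⟨ Σᶠ-cong n (λ i → cong₂ _*_ (x≗cy i) (Σᶠ-cong n (λ j → cong (M i j *_) (x≗cy j)))) ⟩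
  Σᶠ n (λ i → c * y i * Σᶠ n (λ j → M i j * (c * y j)))
    ≡⟨ Σᶠ-cong n (λ i → cong (c * y i *_) (Σᶠ-cong n (λ j → solve 3 (λ m c y → m :* (c :* y) := c :* (m :* y)) refl (M i j) c (y j)))) ⟩
  Σᶠ n (λ i → c * y i * Σᶠ n (λ j → c * (M i j * y j)))
    ≡⟨ Σᶠ-cong n (λ i → cong (c * y i *_) (Σᶠ-*ˡ n c _)) ⟨
  Σᶠ n (λ i → c * y i * (c * (M ·ᵥ y) i))
    ≡⟨ Σᶠ-cong n (λ i → solve 3 (λ c a b → c :* a :* (c :* b) := c :* c :* (a :* b)) refl c (y i) ((M ·ᵥ y) i)) ⟩
  Σᶠ n (λ i → c * c * (y i * (M ·ᵥ y) i))
    ≡⟨ Σᶠ-*ˡ n (c * c) _ ⟨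
  c * c * M [ y ] ∎
  where
  open ≡-Reasoning
  open ℚ-Solver.+-*-Solver

top : ∀ {n} → Fin (dim₀ n)
top = zero

middle : ∀ {n} → Fin n → Fin (dim₀ n)
middle k = suc (k ↑ˡ 1)

bottom : ∀ {n} → Fin (dim₀ n)
bottom {n} = suc (n ↑ʳ zero)

Σᶠ-dim₀ : ∀ n (f : Fin (dim₀ n) → ℚ) → Σᶠ (dim₀ n) f ≡ f top + Σᶠ n (f ∘ middle) + f bottom
Σᶠ-dim₀ n f = trans (cong (λ x → f top + x) (Σᶠ-↑ n 1 (f ∘ suc)))
  (solve 3 (λ a b c → a :+ (b :+ (c :+ con 0ℚ)) := a :+ b :+ c) refl (f top) (Σᶠ n (f ∘ middle)) (f bottom))
  where
  open ℚ-Solver.+-*-Solver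

module _ {n} (S : Mat ℤ n) where

  private
    S₀ℚ : Mat ℚ (dim₀ n)
    S₀ℚ = matℚ (S₀ S)

  S₀-top-middle : ∀ k → S₀ℚ top (middle k) ≡ 0ℚ
  S₀-top-middle k rewrite splitAt-↑ˡ n k 1 = refl

  S₀-top-bottom : S₀ℚ top bottom ≡ 1ℚ
  S₀-top-bottom rewrite splitAt-↑ʳ n 1 zero = refl

  S₀-middle-top : ∀ a → S₀ℚ (middle a) top ≡ 0ℚ
  S₀-middle-top a rewrite splitAt-↑ˡ n a 1 = refl

  S₀-middle-middle : ∀ a b → S₀ℚ (middle a) (middle b) ≡ - matℚ S a b
  S₀-middle-middle a b rewrite splitAt-↑ˡ n a 1 | splitAt-↑ˡ n b 1 = toℚ-neg (S a b)

  S₀-middle-bottom : ∀ a → S₀ℚ (middle a) bottom ≡ 0ℚ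
  S₀-middle-bottom a rewrite splitAt-↑ˡ n a 1 | splitAt-↑ʳ n 1 zero = refl

  S₀-bottom-top : S₀ℚ bottom top ≡ 1ℚ
  S₀-bottom-top rewrite splitAt-↑ʳ n 1 zero = refl

  S₀-bottom-middle : ∀ b → S₀ℚ bottom (middle b) ≡ 0ℚ
  S₀-bottom-middle b rewrite splitAt-↑ʳ n 1 zero = refl

  S₀-bottom-bottom : S₀ℚ bottom bottom ≡ 0ℚ
  S₀-bottom-bottom rewrite splitAt-↑ʳ n 1 zero = refl

  ·ᵥ-S₀-top : ∀ y → (S₀ℚ ·ᵥ y) top ≡ y bottom
  ·ᵥ-S₀-top y = begin
    (S₀ℚ ·ᵥ y) top
      ≡⟨ Σᶠ-dim₀ n (λ j → S₀ℚ top j * y j) ⟩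
    0ℚ * y top + Σᶠ n (λ k → S₀ℚ top (middle k) * y (middle k)) + S₀ℚ top bottom * y bottom
      ≡⟨ cong₂ (λ Σ e → 0ℚ * y top + Σ + e * y bottom)
           (trans (Σᶠ-cong n (λ k → cong (_* y (middle k)) (S₀-top-middle k))) (Σᶠ-zeroˡ n (y ∘ middle)))
           S₀-top-bottom ⟩
    0ℚ * y top + 0ℚ + 1ℚ * y bottom
      ≡⟨ solve 2 (λ t b → con 0ℚ :* t :+ con 0ℚ :+ con 1ℚ :* b := b) refl (y top) (y bottom) ⟩
    y bottom ∎
    where
    open ≡-Reasoning
    open ℚ-Solver.+-*-Solver

  ·ᵥ-S₀-middle : ∀ y a → (S₀ℚ ·ᵥ y) (middle a) ≡ - (matℚ S ·ᵥ (y ∘ middle)) a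
  ·ᵥ-S₀-middle y a = begin
    (S₀ℚ ·ᵥ y) (middle a)
      ≡⟨ Σᶠ-dim₀ n (λ j → S₀ℚ (middle a) j * y j) ⟩
    S₀ℚ (middle a) top * y top + Σᶠ n (λ k → S₀ℚ (middle a) (middle k) * y (middle k)) + S₀ℚ (middle a) bottom * y bottom
      ≡⟨ cong₂ _+_ (cong₂ (λ e Σ → e * y top + Σ) (S₀-middle-top a)
           (Σᶠ-cong n (λ k → trans (cong (_* y (middle k)) (S₀-middle-middle a k)) (sym (ℚP.neg-distribˡ-* (matℚ S a k) (y (middle k)))))))
           (cong (_* y bottom) (S₀-middle-bottom a)) ⟩
    0ℚ * y top + Σᶠ n (λ k → - (matℚ S a k * y (middle k))) + 0ℚ * y bottom
      ≡⟨ solve 3 (λ t Σ b → con 0ℚ :* t :+ Σ :+ con 0ℚ :* b := Σ) refl (y top) _ (y bottom) ⟩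
    Σᶠ n (λ k → - (matℚ S a k * y (middle k)))
      ≡⟨ Σᶠ-neg n _ ⟨
    - (matℚ S ·ᵥ (y ∘ middle)) a ∎
    where
    open ≡-Reasoning
    open ℚ-Solver.+-*-Solver

  ·ᵥ-S₀-bottom : ∀ y → (S₀ℚ ·ᵥ y) bottom ≡ y top
  ·ᵥ-S₀-bottom y = begin
    (S₀ℚ ·ᵥ y) bottom
      ≡⟨ Σᶠ-dim₀ n (λ j → S₀ℚ bottom j * y j) ⟩
    S₀ℚ bottom top * y top + Σᶠ n (λ k → S₀ℚ bottom (middle k) * y (middle k)) + S₀ℚ bottom bottom * y bottom
      ≡⟨ cong₂ _+_ (cong₂ (λ e Σ → e * y top + Σ) S₀-bottom-top
           (trans (Σᶠ-cong n (λ k → cong (_* y (middle k)) (S₀-bottom-middle k))) (Σᶠ-zeroˡ n (y ∘ middle))))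
           (cong (_* y bottom) S₀-bottom-bottom) ⟩
    1ℚ * y top + 0ℚ + 0ℚ * y bottom
      ≡⟨ solve 2 (λ t b → con 1ℚ :* t :+ con 0ℚ :+ con 0ℚ :* b := t) refl (y top) (y bottom) ⟩
    y top ∎
    where
    open ≡-Reasoning
    open ℚ-Solver.+-*-Solver

  bil-S₀ : ∀ x y → bil S₀ℚ x y ≡ x top * y bottom + x bottom * y top - bil (matℚ S) (x ∘ middle) (y ∘ middle)
  bil-S₀ x y = begin
    bil S₀ℚ x y
      ≡⟨ Σᶠ-dim₀ n (λ i → x i * (S₀ℚ ·ᵥ y) i) ⟩
    x top * (S₀ℚ ·ᵥ y) top + Σᶠ n (λ k → x (middle k) * (S₀ℚ ·ᵥ y) (middle k)) + x bottom * (S₀ℚ ·ᵥ y) bottom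
      ≡⟨ cong₂ _+_ (cong₂ _+_ (cong (x top *_) (·ᵥ-S₀-top y)) middle-sum) (cong (x bottom *_) (·ᵥ-S₀-bottom y)) ⟩
    x top * y bottom + - bil (matℚ S) (x ∘ middle) (y ∘ middle) + x bottom * y top
      ≡⟨ solve 3 (λ a B c → a :+ :- B :+ c := a :+ c :- B) refl (x top * y bottom) (bil (matℚ S) (x ∘ middle) (y ∘ middle)) (x bottom * y top) ⟩
    x top * y bottom + x bottom * y top - bil (matℚ S) (x ∘ middle) (y ∘ middle) ∎
    where
    open ≡-Reasoning
    open ℚ-Solver.+-*-Solver
    middle-sum : Σᶠ n (λ k → x (middle k) * (S₀ℚ ·ᵥ y) (middle k)) ≡ - bil (matℚ S) (x ∘ middle) (y ∘ middle)
    middle-sum = trans (Σᶠ-cong n (λ k → trans (cong (x (middle k) *_) (·ᵥ-S₀-middle y k)) (sym (ℚP.neg-distribʳ-* (x (middle k)) _))))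
                       (sym (Σᶠ-neg n (λ k → x (middle k) * (matℚ S ·ᵥ (y ∘ middle)) k)))

triple-middle : ∀ {n} a (v : Vec ℚ n) b k → triple a v b (middle k) ≡ v k
triple-middle {n} a v b k rewrite splitAt-↑ˡ n k 1 = refl

triple-bottom : ∀ {n} a (v : Vec ℚ n) b → triple a v b bottom ≡ b
triple-bottom {n} a v b rewrite splitAt-↑ʳ n 1 zero = refl

tripleℤ : ∀ {n} → ℤ → Vec ℤ n → ℤ → Vec ℤ (dim₀ n)
tripleℤ a v b zero = a
tripleℤ {n} a v b (suc i) with splitAt n i
... | inj₁ k = v k
... | inj₂ _ = b

tripleℤ-middle : ∀ {n} a (v : Vec ℤ n) b k → tripleℤ a v b (middle k) ≡ v k
tripleℤ-middle {n} a v b k rewrite splitAt-↑ˡ n k 1 = refl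

tripleℤ-bottom : ∀ {n} a (v : Vec ℤ n) b → tripleℤ a v b bottom ≡ b
tripleℤ-bottom {n} a v b rewrite splitAt-↑ʳ n 1 zero = refl

φ₀-triple : ∀ {n} (S : Mat ℤ n) a v b y →
            φ₀ S (triple a v b) y ≡ ½ * (a * y bottom + b * y top - bil (matℚ S) v (y ∘ middle))
φ₀-triple S a v b y = cong (½ *_) (trans (bil-S₀ S (triple a v b) y)
  (cong₂ (λ β B → a * y bottom + β * y top - B) (triple-bottom a v b) (bil-congˡ (matℚ S) (triple-middle a v b) (y ∘ middle))))

ℕ-identity⇒ℤ : ∀ {d x m y n} → d ℕ.+ y ℕ.* n ≡ x ℕ.* m → + d ≡ + x ℤ.* + m ℤ.- + y ℤ.* + n
ℕ-identity⇒ℤ {d} {x} {m} {y} {n} eq = begin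
  + d                                   ≡⟨ solve 2 (λ d e → d := d :+ e :- e) refl (+ d) (+ y ℤ.* + n) ⟩
  + d ℤ.+ + y ℤ.* + n ℤ.- + y ℤ.* + n    ≡⟨ cong (ℤ._- + y ℤ.* + n) lifted ⟩
  + x ℤ.* + m ℤ.- + y ℤ.* + n            ∎
  where
  open ≡-Reasoning
  open ℤ-Solver.+-*-Solver
  lifted : + d ℤ.+ + y ℤ.* + n ≡ + x ℤ.* + m
  lifted = begin
    + d ℤ.+ + y ℤ.* + n    ≡⟨ cong (λ e → + d ℤ.+ e) (ℤP.pos-* y n) ⟨
    + d ℤ.+ + (y ℕ.* n)    ≡⟨ ℤP.pos-+ d (y ℕ.* n) ⟨
    + (d ℕ.+ y ℕ.* n)      ≡⟨ cong +_ eq ⟩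
    + (x ℕ.* m)            ≡⟨ ℤP.pos-* x m ⟩
    + x ℤ.* + m            ∎

Bézout-identity⇒ℤ : ∀ {d m n} → Bézout.Identity d m n → ∃[ α ] ∃[ β ] + d ≡ + m ℤ.* α ℤ.+ + n ℤ.* β
Bézout-identity⇒ℤ {m = m} {n} (Bézout.+- x y eq) = + x , ℤ.- + y ,
  trans (ℕ-identity⇒ℤ {x = x} {m} {y} {n} eq) (solve 4 (λ x m y n → x :* m :- y :* n := m :* x :+ n :* (:- y)) refl (+ x) (+ m) (+ y) (+ n))
  where
  open ℤ-Solver.+-*-Solver
Bézout-identity⇒ℤ {m = m} {n} (Bézout.-+ x y eq) = ℤ.- + x , + y ,
  trans (ℕ-identity⇒ℤ {x = y} {n} {x} {m} eq) (solve 4 (λ x m y n → y :* n :- x :* m := m :* (:- x) :+ n :* y) refl (+ x) (+ m) (+ y) (+ n))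
  where
  open ℤ-Solver.+-*-Solver

bézout-∑ : ∀ {n} (a : Fin n → ℤ) →
           ∃[ g ] (∀ j → + g ∣ a j) × (∃ λ (w : Fin n → ℤ) → + g ≡ ΣZ.sum (λ j → a j ℤ.* w j))
bézout-∑ {zero} a = 0 , (λ ()) , (λ ()) , refl
bézout-∑ {suc n} a with bézout-∑ (a ∘ suc)
... | g , g∣a′ , w , g≡∑ with Bézout.lemma ℤ.∣ a zero ∣ g
... | Bézout.result h h-gcd h-identity with Bézout-identity⇒ℤ h-identity | m∣∣m∣ {a zero}
... | α , β , h≡ | divides σ ∣a₀∣≡ = h , h∣a , (σ ℤ.* α) ∷ (λ j → w j ℤ.* β) , h≡∑
  where
  open ≡-Reasoning
  open ℤ-Solver.+-*-Solver
  h∣a : ∀ j → + h ∣ a j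
  h∣a zero    = ∣ᵤ⇒∣ (proj₁ (GCD.commonDivisor h-gcd))
  h∣a (suc j) = ∣-trans (∣ᵤ⇒∣ (proj₂ (GCD.commonDivisor h-gcd))) (g∣a′ j)
  h≡∑ : + h ≡ a zero ℤ.* (σ ℤ.* α) ℤ.+ ΣZ.sum (λ j → a (suc j) ℤ.* (w j ℤ.* β))
  h≡∑ = begin
    + h                                                           ≡⟨ h≡ ⟩
    + ℤ.∣ a zero ∣ ℤ.* α ℤ.+ + g ℤ.* β                            ≡⟨ cong₂ (λ A G → A ℤ.* α ℤ.+ G ℤ.* β) ∣a₀∣≡ g≡∑ ⟩
    σ ℤ.* a zero ℤ.* α ℤ.+ ΣZ.sum (λ j → a (suc j) ℤ.* w j) ℤ.* β
      ≡⟨ cong₂ ℤ._+_ (solve 3 (λ σ a α → σ :* a :* α := a :* (σ :* α)) refl σ (a zero) α) (ΣZ.*-distribʳ-sum β (λ j → a (suc j) ℤ.* w j)) ⟩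
    a zero ℤ.* (σ ℤ.* α) ℤ.+ ΣZ.sum (λ j → a (suc j) ℤ.* w j ℤ.* β)
      ≡⟨ cong (λ e → a zero ℤ.* (σ ℤ.* α) ℤ.+ e) (ΣZ.sum-cong-≗ (λ j → ℤP.*-assoc (a (suc j)) (w j) β)) ⟩
    a zero ℤ.* (σ ℤ.* α) ℤ.+ ΣZ.sum (λ j → a (suc j) ℤ.* (w j ℤ.* β)) ∎

½qT[s]∈g²ℤ : ∀ {n} (T : Mat ℚ n) q → LevelProp T q → ∀ g (s : Vec ℤ n) → (∀ j → + g ∣ s j) →
             ∃[ N ] ½ * toℚ (+ q) * T [ vecℚ s ] ≡ toℚ (+ g ℤ.* + g ℤ.* N)
½qT[s]∈g²ℤ {n} T q level g s g∣s = N , (begin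
  ½ * Q * T [ vecℚ s ]            ≡⟨ cong (½ * Q *_) ([]-scale T G s≡g*s′) ⟩
  ½ * Q * (G * G * T [ vecℚ s′ ])  ≡⟨ solve 4 (λ h Q G X → h :* Q :* (G :* G :* X) := G :* G :* (h :* Q :* X)) refl ½ Q G (T [ vecℚ s′ ]) ⟩
  G * G * (½ * Q * T [ vecℚ s′ ])  ≡⟨ cong (G * G *_) N≡ ⟩
  G * G * toℚ N                    ≡⟨ trans (toℚ-* (+ g ℤ.* + g) N) (cong (_* toℚ N) (toℚ-* (+ g) (+ g))) ⟨
  toℚ (+ g ℤ.* + g ℤ.* N)          ∎)
  where
  open ≡-Reasoning
  open ℚ-Solver.+-*-Solver
  Q : ℚ
  Q = toℚ (+ q)
  G : ℚ
  G = toℚ (+ g)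
  s′ : Vec ℤ n
  s′ j = _∣_.quotient (g∣s j)
  s≡g*s′ : ∀ j → vecℚ s j ≡ G * vecℚ s′ j
  s≡g*s′ j = trans (cong toℚ (_∣_.equality (g∣s j))) (trans (toℚ-* (s′ j) (+ g)) (ℚP.*-comm (vecℚ s′ j) G))
  N : ℤ
  N = proj₁ (level s′)
  N≡ : ½ * Q * T [ vecℚ s′ ] ≡ toℚ N
  N≡ = proj₂ (level s′)

unit-combination : ∀ {n} d (s : Vec ℤ n) D → Coprime ℤ.∣ D ∣ d →
                   (∀ g → + g ∣ + d → (∀ j → + g ∣ s j) → + g ∣ D) →
                   ∃ λ (w : Fin (suc n) → ℤ) → + 1 ≡ + d ℤ.* w zero ℤ.+ ΣZ.sum (λ j → s j ℤ.* w (suc j))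
unit-combination d s D coprime common∣D with bézout-∑ (+ d ∷ s)
... | g , g∣ , w , g≡∑ = w , trans (cong +_ (sym g≡1)) g≡∑
  where
  g≡1 : g ≡ 1
  g≡1 = coprime (∣⇒∣ᵤ (common∣D g (g∣ zero) (g∣ ∘ suc)) , ∣⇒∣ᵤ (g∣ zero))

module ξ-properties {n} (S : Mat ℤ n) (S-sym : Symmetric S) (T : Mat ℚ n) (S·T≡I : matℚ S ·ₘ T ≡ idMat)
  (q d : ℕ) {{_ : NonZero q}} {{_ : NonZero d}} (D : ℤ) (s : Vec ℤ n) (k : ℤ)
  (H : ½ * toℚ (+ q) * (T [ vecℚ s ]) - toℚ D ≡ toℚ (k ℤ.* + (q ℕ.* d)))
  where

  open ≡-Reasoning

  private
    Q : ℚ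
    Q = toℚ (+ q)
    δ : ℚ
    δ = toℚ (+ d)
    K : ℚ
    K = toℚ k
    X : ℚ
    X = T [ vecℚ s ]

  ξ : Vec ℚ (dim₀ n)
  ξ = triple (divℚ (½ * Q * X - toℚ D) (q ℕ.* d)) (T ·ᵥ vecℚ s) δ

  ξ-top : ξ top ≡ K
  ξ-top = begin
    divℚ (½ * Q * X - toℚ D) (q ℕ.* d)          ≡⟨ cong (λ r → divℚ r (q ℕ.* d)) (trans H (toℚ-* k (+ (q ℕ.* d)))) ⟩
    divℚ (K * toℚ (+ (q ℕ.* d))) (q ℕ.* d)      ≡⟨ cong (λ r → divℚ r (q ℕ.* d)) (ℚP.*-comm K _) ⟩
    divℚ (toℚ (+ (q ℕ.* d)) * K) (q ℕ.* d)      ≡⟨ divℚ[m*r,m]≡r (q ℕ.* d) {{ℕP.m*n≢0 q d}} K ⟩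
    K                                           ∎

  toℚ-D : toℚ D ≡ ½ * Q * X - toℚ (k ℤ.* + (q ℕ.* d))
  toℚ-D = begin
    toℚ D                         ≡⟨ solve 2 (λ A D → D := A :- (A :- D)) refl (½ * Q * X) (toℚ D) ⟩
    ½ * Q * X - (½ * Q * X - toℚ D) ≡⟨ cong (λ t → ½ * Q * X - t) H ⟩
    ½ * Q * X - toℚ (k ℤ.* + (q ℕ.* d)) ∎
    where
    open ℚ-Solver.+-*-Solver

  φ₀-ξ-expand : ∀ y → φ₀ S ξ y ≡ ½ * (K * y bottom + δ * y top - Σᶠ n (λ i → vecℚ s i * y (middle i)))
  φ₀-ξ-expand y = trans (φ₀-triple S (ξ top) (T ·ᵥ vecℚ s) δ y) (cong₂ (λ a B → ½ * (a * y bottom + δ * y top - B)) ξ-top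
    (bil-inverse (λ i j → cong toℚ (S-sym i j)) S·T≡I (vecℚ s) (y ∘ middle)))

  φ₀[ξ] : φ₀ S ξ ξ ≡ divℚ (toℚ (ℤ.- D)) q
  φ₀[ξ] = begin
    φ₀ S ξ ξ
      ≡⟨ φ₀-ξ-expand ξ ⟩
    ½ * (K * ξ bottom + δ * ξ top - Σᶠ n (λ i → vecℚ s i * ξ (middle i)))
      ≡⟨ cong₂ (λ b t → ½ * (K * b + δ * t - Σᶠ n (λ i → vecℚ s i * ξ (middle i)))) (triple-bottom (ξ top) (T ·ᵥ vecℚ s) δ) ξ-top ⟩
    ½ * (K * δ + δ * K - Σᶠ n (λ i → vecℚ s i * ξ (middle i)))
      ≡⟨ cong (λ Σ → ½ * (K * δ + δ * K - Σ)) (Σᶠ-cong n (λ i → cong (vecℚ s i *_) (triple-middle (ξ top) (T ·ᵥ vecℚ s) δ i))) ⟩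
    ½ * (K * δ + δ * K - X)
      ≡⟨ solve 4 (λ h K δ X → h :* (K :* δ :+ δ :* K :- X) := h :* (K :* δ :+ K :* δ) :- h :* X) refl ½ K δ X ⟩
    ½ * (K * δ + K * δ) - ½ * X
      ≡⟨ cong (_- ½ * X) (½*[p+p]≡p (K * δ)) ⟩
    K * δ - ½ * X
      ≡⟨ divℚ[m*r,m]≡r q (K * δ - ½ * X) ⟨
    divℚ (Q * (K * δ - ½ * X)) q
      ≡⟨ cong (λ r → divℚ r q) toℚ[-D] ⟨
    divℚ (toℚ (ℤ.- D)) q ∎
    where
    open ℚ-Solver.+-*-Solver
    toℚ[-D] : toℚ (ℤ.- D) ≡ Q * (K * δ - ½ * X)
    toℚ[-D] = begin
      toℚ (ℤ.- D)                                    ≡⟨ toℚ-neg D ⟩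
      - toℚ D                                        ≡⟨ cong -_ toℚ-D ⟩
      - (½ * Q * X - toℚ (k ℤ.* + (q ℕ.* d)))        ≡⟨ cong (λ t → - (½ * Q * X - t)) (trans (toℚ-* k (+ (q ℕ.* d))) (cong (K *_) (trans (cong toℚ (ℤP.pos-* q d)) (toℚ-* (+ q) (+ d))))) ⟩
      - (½ * Q * X - K * (Q * δ))                    ≡⟨ solve 5 (λ h Q X K δ → :- (h :* Q :* X :- K :* (Q :* δ)) := Q :* (K :* δ :- h :* X)) refl ½ Q X K δ ⟩
      Q * (K * δ - ½ * X)                            ∎

  ℓ : Vec ℤ (dim₀ n) → ℤ
  ℓ y = k ℤ.* y bottom ℤ.+ + d ℤ.* y top ℤ.- ΣZ.sum (λ i → s i ℤ.* y (middle i))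

  φ₀[ξ,y]≡ℓ[y]/2 : ∀ y → φ₀ S ξ (vecℚ y) ≡ ℓ y / 2
  φ₀[ξ,y]≡ℓ[y]/2 y = begin
    φ₀ S ξ (vecℚ y)
      ≡⟨ φ₀-ξ-expand (vecℚ y) ⟩
    ½ * (K * toℚ (y bottom) + δ * toℚ (y top) - Σᶠ n (λ i → vecℚ s i * toℚ (y (middle i))))
      ≡⟨ cong (½ *_) toℚ-ℓ ⟨
    ½ * toℚ (ℓ y)
      ≡⟨ ½*z≡z/2 (ℓ y) ⟩
    ℓ y / 2 ∎
    where
    toℚ-ℓ : toℚ (ℓ y) ≡ K * toℚ (y bottom) + δ * toℚ (y top) - Σᶠ n (λ i → vecℚ s i * toℚ (y (middle i)))
    toℚ-ℓ = trans (toℚ-- (k ℤ.* y bottom ℤ.+ + d ℤ.* y top) (ΣZ.sum (λ i → s i ℤ.* y (middle i)))) (cong₂ _-_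
      (trans (toℚ-+ (k ℤ.* y bottom) (+ d ℤ.* y top)) (cong₂ _+_ (toℚ-* k (y bottom)) (toℚ-* (+ d) (y top))))
      (trans (toℚ-sum n (λ i → s i ℤ.* y (middle i))) (Σᶠ-cong n (λ i → toℚ-* (s i) (y (middle i))))))

  φ₀[ξ,y]∈½ℤ : ∀ y → In½ℤ (φ₀ S ξ (vecℚ y))
  φ₀[ξ,y]∈½ℤ y = ℓ y , φ₀[ξ,y]≡ℓ[y]/2 y

  D≡g²N-kqd : ∀ g N → ½ * Q * X ≡ toℚ (+ g ℤ.* + g ℤ.* N) → D ≡ + g ℤ.* + g ℤ.* N ℤ.- k ℤ.* + (q ℕ.* d)
  D≡g²N-kqd g N N≡ = toℚ-injective (begin
    toℚ D                                                  ≡⟨ toℚ-D ⟩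
    ½ * Q * X - toℚ (k ℤ.* + (q ℕ.* d))                    ≡⟨ cong (_- toℚ (k ℤ.* + (q ℕ.* d))) N≡ ⟩
    toℚ (+ g ℤ.* + g ℤ.* N) - toℚ (k ℤ.* + (q ℕ.* d))      ≡⟨ toℚ-- (+ g ℤ.* + g ℤ.* N) (k ℤ.* + (q ℕ.* d)) ⟨
    toℚ (+ g ℤ.* + g ℤ.* N ℤ.- k ℤ.* + (q ℕ.* d))          ∎)

  common-divisor-∣D : LevelProp T q → ∀ g → + g ∣ + d → (∀ j → + g ∣ s j) → + g ∣ D
  common-divisor-∣D level g g∣d g∣s = subst (+ g ∣_) (sym (D≡g²N-kqd g N N≡)) (∣m∣n⇒∣m-n g∣g²N (∣n⇒∣m*n k g∣qd))
    where
    N : ℤ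
    N = proj₁ (½qT[s]∈g²ℤ T q level g s g∣s)
    N≡ : ½ * Q * X ≡ toℚ (+ g ℤ.* + g ℤ.* N)
    N≡ = proj₂ (½qT[s]∈g²ℤ T q level g s g∣s)
    g∣g²N : + g ∣ + g ℤ.* + g ℤ.* N
    g∣g²N = ∣m⇒∣m*n N (∣m⇒∣m*n (+ g) (∣-refl {+ g}))
    g∣qd : + g ∣ + (q ℕ.* d)
    g∣qd = subst (+ g ∣_) (sym (ℤP.pos-* q d)) (∣n⇒∣m*n (+ q) g∣d)

  ℓ-onto : (∃ λ (w : Fin (suc n) → ℤ) → + 1 ≡ + d ℤ.* w zero ℤ.+ ΣZ.sum (λ j → s j ℤ.* w (suc j))) →
           ∀ z → ∃[ y ] ℓ y ≡ z
  ℓ-onto (w , 1≡) z = y , (begin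
    ℓ y
      ≡⟨ cong₂ (λ b Σ → k ℤ.* b ℤ.+ + d ℤ.* (z ℤ.* w zero) ℤ.- Σ) (tripleℤ-bottom (z ℤ.* w zero) y′ (+ 0))
           (ΣZ.sum-cong-≗ (λ i → cong (s i ℤ.*_) (tripleℤ-middle (z ℤ.* w zero) y′ (+ 0) i))) ⟩
    k ℤ.* + 0 ℤ.+ + d ℤ.* (z ℤ.* w zero) ℤ.- ΣZ.sum (λ j → s j ℤ.* ℤ.- (z ℤ.* w (suc j)))
      ≡⟨ cong (λ Σ → k ℤ.* + 0 ℤ.+ + d ℤ.* (z ℤ.* w zero) ℤ.- Σ) Σ-scale ⟩
    k ℤ.* + 0 ℤ.+ + d ℤ.* (z ℤ.* w zero) ℤ.- ℤ.- z ℤ.* Σw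
      ≡⟨ solve 5 (λ k d z u Σ → k :* con (+ 0) :+ d :* (z :* u) :- (:- z) :* Σ := z :* (d :* u :+ Σ)) refl k (+ d) z (w zero) Σw ⟩
    z ℤ.* (+ d ℤ.* w zero ℤ.+ Σw)
      ≡⟨ cong (z ℤ.*_) 1≡ ⟨
    z ℤ.* + 1
      ≡⟨ ℤP.*-identityʳ z ⟩
    z ∎)
    where
    open ℤ-Solver.+-*-Solver
    Σw : ℤ
    Σw = ΣZ.sum (λ j → s j ℤ.* w (suc j))
    y′ : Vec ℤ n
    y′ j = ℤ.- (z ℤ.* w (suc j))
    y : Vec ℤ (dim₀ n)
    y = tripleℤ (z ℤ.* w zero) y′ (+ 0)
    Σ-scale : ΣZ.sum (λ j → s j ℤ.* ℤ.- (z ℤ.* w (suc j))) ≡ ℤ.- z ℤ.* Σw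
    Σ-scale = trans
      (ΣZ.sum-cong-≗ (λ j → solve 3 (λ s z w → s :* (:- (z :* w)) := (:- z) :* (s :* w)) refl (s j) z (w (suc j))))
      (sym (ΣZ.*-distribˡ-sum (ℤ.- z) (λ j → s j ℤ.* w (suc j))))

  ½ℤ⊆φ₀[ξ,L₀] : LevelProp T q → Coprime ℤ.∣ D ∣ d → ∀ r → In½ℤ r → ∃[ y ] φ₀ S ξ (vecℚ y) ≡ r
  ½ℤ⊆φ₀[ξ,L₀] level coprime r (z , r≡) = from-ℓ (ℓ-onto (unit-combination d s D coprime (common-divisor-∣D level)) z)
    where
    from-ℓ : (∃[ y ] ℓ y ≡ z) → ∃[ y ] φ₀ S ξ (vecℚ y) ≡ r
    from-ℓ (y , ℓy≡z) = y , trans (φ₀[ξ,y]≡ℓ[y]/2 y) (trans (cong (λ t → t / 2) ℓy≡z) (sym r≡))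

lemma6p7 : (n : ℕ) → 1 ℕ.≤ n → (S : Mat ℤ n) → Symmetric S → Even S → PosDef S
    → (Sinv : Mat ℚ n) → IsInverse S Sinv
    → (q : ℕ) → IsLevel Sinv q
    → (D : ℤ) → D ℤ.≤ + 0 → (d : ℕ) → 1 ℕ.≤ d → Coprime (ℤ.∣ D ∣) d
    → (s : Vec ℤ n)
    → (∃ λ (k : ℤ) → (½ ℚ.* toℚ (+ q) ℚ.* (Sinv [ vecℚ s ])) ℚ.- toℚ D ≡ toℚ (k ℤ.* + (q ℕ.* d)))
    → InL₀½ℤ (divℚ (toℚ (ℤ.- D)) q) S
        (triple (divℚ ((½ ℚ.* toℚ (+ q) ℚ.* (Sinv [ vecℚ s ])) ℚ.- toℚ D) (q ℕ.* d))
                (Sinv ·ᵥ vecℚ s)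
                (toℚ (+ d)))
lemma6p7 n _ S S-sym _ _ T (S·T≡I , _) q (0<q , level , _) D _ d 1≤d coprime s (k , H) =
  φ₀[ξ] , φ₀[ξ,y]∈½ℤ , ½ℤ⊆φ₀[ξ,L₀] level coprime
  where
  open ξ-properties S S-sym T S·T≡I q d {{ℕ.>-nonZero 0<q}} {{ℕ.>-nonZero 1≤d}} D s k H
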